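{- Let $A$ be an induced subgraph of a digraph $X$ and suppose $X$ admits a projecting decomposition $\pi$ with respect to $A$. Then for any $x\in X^A_V$, $\pi x$ is the unique vertex of $A$ admitting a path from $x$ of length $h(x)$. In particular, if $x\in A_V$ then $\pi x=x$, while if $h(x)=1$ then $\pi x$ is the unique vertex of $A$ admitting an edge from $x$.
   Context: A digraph $X$ is a set $X_V$ with a reflexive binary relation ($x\to y$ an edge). Induced subgraph $A\subseteq X$: for $a,b\in A_V$, $a\to b$ in $A$ iff in $X$. A path of length $n$ from $x$ to $y$ is a sequence $x=v_0,\dots,v_n=y$ with $v_i\to v_{i+1}$. $X^A$ is the induced subgraph on vertices admitting a path to some vertex of $A$; for $x\in X^A_V$, the height $h(x)$ is the minimal length of a path from $x$ to a vertex of $A$. A projecting decomposition of $X$ w.r.t. $A$ is a function $\pi\colon X^A_V\to A_V$ such that for any $x\in X_V$ and any $a\in A_V$ admitting a path from $x$, there is a path from $x$ to $a$ of minimal length (among paths from $x$ to $a$) passing through $\pi x$. -}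

module Defs where

open import Level using (Level; _⊔_)
open import Data.Nat using (ℕ; zero; suc; _≤_)
open import Data.Product using (Σ; ∃; _×_; _,_; proj₁)
open import Relation.Binary.PropositionalEquality using (_≡_)

record Digraph (v e : Level) : Set (Level.suc (v ⊔ e)) where
  field
    V       : Set v
    _⟶_     : V → V → Set e
    ⟶-refl  : ∀ x → x ⟶ x

module _ {v e : Level} (X : Digraph v e) where
  open Digraph X

  data Path : V → V → ℕ → Set (v ⊔ e) where
    []  : ∀ {x} → Path x x zero
    _∷_ : ∀ {x y z n} → x ⟶ y → Path y z n → Path x z (suc n)

  data _∈P_ (w : V) : ∀ {x y n} → Path x y n → Set (v ⊔ e) where
    here  : ∀ {y n} {p : Path w y n} → w ∈P p
    there : ∀ {x y z n} {ε : x ⟶ y} {p : Path y z n} → w ∈P p → w ∈P (ε ∷ p)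

  Reach : V → V → Set (v ⊔ e)
  Reach x y = ∃ λ n → Path x y n

  -- An induced subgraph A of X is determined by its vertex set, given as a
  -- predicate on V; its edges are exactly the edges of X between them.
  module _ {a : Level} (A : V → Set a) where

    AV : Set (v ⊔ a)
    AV = Σ V A

    ReachA : V → Set (v ⊔ e ⊔ a)
    ReachA x = ∃ λ b → A b × Reach x b

    XAV : Set (v ⊔ e ⊔ a)
    XAV = Σ V ReachA

    IsHeight : V → ℕ → Set (v ⊔ e ⊔ a)
    IsHeight x n = (∃ λ b → A b × Path x b n)
                 × (∀ b m → A b → Path x b m → n ≤ m)

    IsMinimal : ∀ {x y n} → Path x y n → Set (v ⊔ e)
    IsMinimal {x} {y} {n} p = ∀ m → Path x y m → n ≤ m

    IsProjecting : (XAV → AV) → Set (v ⊔ e ⊔ a)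
    IsProjecting π =
      (x : XAV) (b : AV) → Reach (proj₁ x) (proj₁ b) →
      ∃ λ n → Σ (Path (proj₁ x) (proj₁ b) n) λ p →
        IsMinimal p × proj₁ (π x) ∈P p

{-# OPTIONS --safe #-}
-- Take a path of length h(x) from x to some b in A.  The projecting
-- decomposition gives a shortest path from x to b, of length n ≤ h(x), through
-- π x.  Since π x lies in A, every path from x to π x has length ≥ h(x) ≥ n; a
-- vertex on a path of length n that cannot be reached in fewer than n steps
-- must be its endpoint, so π x = b.
module Submission where

open import Defs
open import Level using (Level)
open import Data.Nat using (suc; _≤_; z≤n; s≤s⁻¹)
open import Data.Nat.Properties using (≤-trans)
open import Data.Product using (_×_; _,_; proj₁; proj₂)
open import Relation.Binary.PropositionalEquality using (_≡_; refl; sym; subst)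

module _ {v e : Level} (X : Digraph v e) where
  open Digraph X

  Path-zero⇒≡ : ∀ {x y} → Path X x y 0 → x ≡ y
  Path-zero⇒≡ [] = refl

  Path-one⇒⟶ : ∀ {x y} → Path X x y 1 → x ⟶ y
  Path-one⇒⟶ (ε ∷ []) = ε

  ∈P-unreachable-earlier⇒endpoint : ∀ {w x y n} (p : Path X x y n) → _∈P_ X w p →
    (∀ k → Path X x w k → n ≤ k) → w ≡ y
  ∈P-unreachable-earlier⇒endpoint []      here      _ = refl
  ∈P-unreachable-earlier⇒endpoint (_ ∷ _) here      n≤ with n≤ 0 []
  ... | ()
  ∈P-unreachable-earlier⇒endpoint (ε ∷ p) (there w∈p) n≤ =
    ∈P-unreachable-earlier⇒endpoint p w∈p λ k q → s≤s⁻¹ (n≤ (suc k) (ε ∷ q))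

  module _ {a : Level} (A : V → Set a) where

    IsHeight-zero : ∀ {x} → A x → IsHeight X A x 0
    IsHeight-zero {x} Ax = (x , Ax , []) , λ _ _ _ _ → z≤n

    module Projection (π : XAV X A → AV X A) (isProjecting : IsProjecting X A π) where

      height-path-ends-at-π : (x : XAV X A) → ∀ {h} → IsHeight X A (proj₁ x) h →
        ∀ b → A b → Path X (proj₁ x) b h → b ≡ proj₁ (π x)
      height-path-ends-at-π x {h} (_ , height-minimal) b Ab q
        with isProjecting x (b , Ab) (h , q)
      ... | n , r , r-minimal , πx∈r =
        sym (∈P-unreachable-earlier⇒endpoint r πx∈r n≤path-to-πx)
        where
          n≤path-to-πx : ∀ k → Path X (proj₁ x) (proj₁ (π x)) k → n ≤ k
          n≤path-to-πx k p =
            ≤-trans (r-minimal h q) (height-minimal _ k (proj₂ (π x)) p)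

      height-path-to-π : (x : XAV X A) → ∀ {h} → IsHeight X A (proj₁ x) h →
        Path X (proj₁ x) (proj₁ (π x)) h
      height-path-to-π x H@((b , Ab , q) , _) =
        subst (λ c → Path X (proj₁ x) c _) (height-path-ends-at-π x H b Ab q) q

lemma2p4 : ∀ {v e a : Level} (X : Digraph v e) (A : Digraph.V X → Set a)
    (π : XAV X A → AV X A) → IsProjecting X A π →
    (x : XAV X A) →
      (∀ h → IsHeight X A (proj₁ x) h →
        Path X (proj₁ x) (proj₁ (π x)) h
        × (∀ b → A b → Path X (proj₁ x) b h → b ≡ proj₁ (π x)))
      × (A (proj₁ x) → proj₁ (π x) ≡ proj₁ x)
      × (IsHeight X A (proj₁ x) 1 →
          Digraph._⟶_ X (proj₁ x) (proj₁ (π x))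
          × (∀ b → A b → Digraph._⟶_ X (proj₁ x) b → b ≡ proj₁ (π x)))
lemma2p4 X A π isProjecting x =
    (λ h H → height-path-to-π x H , height-path-ends-at-π x H)
  , (λ Ax → sym (Path-zero⇒≡ X (height-path-to-π x (IsHeight-zero X A Ax))))
  , (λ H → Path-one⇒⟶ X (height-path-to-π x H)
         , λ b Ab ε → height-path-ends-at-π x H b Ab (ε ∷ []))
  where open Projection X A π isProjecting
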